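{- Let $b_0 \leq b_1 \leq b_2 \leq \cdots$ be a nondecreasing sequence of nonnegative integers (the barrier). For $n \geq 0$, let $f(n)$ denote the number of integer sequences $(a_0, a_1, \ldots, a_n)$ with $0 \leq a_0 \leq a_1 \leq \cdots \leq a_n$ and $a_j \leq b_j$ for all $0 \leq j \leq n$. Then for every $n = 0, 1, 2, \ldots$, $$f(n) = (-1)^n \binom{b_0 + 1}{n+1} + \sum_{0 \leq m < n} (-1)^{m+n+1} \binom{1+b_{m+1}}{n-m} f(m).$$
   Context: Binomial coefficients $\binom{N}{k}$ with $N$ a nonnegative integer and $k > N$ are equal to $0$. -}

module Defs where

open import Data.Nat using (ℕ; zero; suc; _+_; _∸_; _≤?_)
open import Data.Nat.Combinatorics using (_C_)
open import Data.List using (List; []; _∷_; map; concatMap; upTo; filter; length)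
open import Data.List.Relation.Unary.Linked using (Linked; linked?)
open import Data.Integer as ℤ using (ℤ; +_; -_)
open import Function using (_∘_)

box : (b : ℕ → ℕ) → (k : ℕ) → List (List ℕ)
box b zero    = [] ∷ []
box b (suc k) = concatMap (λ x → map (x ∷_) (box (b ∘ suc) k)) (upTo (suc (b 0)))

f : (b : ℕ → ℕ) → ℕ → ℕ
f b n = length (filter (linked? _≤?_) (box b (suc n)))

sgn : ℕ → ℤ
sgn zero          = + 1
sgn (suc zero)    = - (+ 1)
sgn (suc (suc k)) = sgn k

sumBelow : ℕ → (ℕ → ℤ) → ℤ
sumBelow zero    g = + 0
sumBelow (suc n) g = sumBelow n g ℤ.+ g n

module Submission where

-- For the chains counted by f(m) let P_m(r) = Σ C(a_m, r), so that P_m(0) = f(m).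
-- Every such chain ends at some y ≤ b_m ≤ b_{m+1}, and the hockey-stick identity
-- C(1 + b_{m+1}, r + 1) = C(y, r + 1) + Σ_{y ≤ z ≤ b_{m+1}} C(z, r), summed over
-- all of them, gives C(1 + b_{m+1}, r + 1) f(m) = P_m(r + 1) + P_{m+1}(r).
-- Hence, writing n = k + r, the leading term plus the first k terms of the sum
-- telescope to (-1)^r P_k(r); for k = n, r = 0 this is f(n).

open import Defs
open import Data.Bool using (Bool; true; false; _∧_; if_then_else_)
open import Data.Integer as ℤ using (ℤ; +_)
import Data.Integer.Properties as ℤ
open import Data.Integer.Tactic.RingSolver using (solve-∀)
import Data.Nat.Tactic.RingSolver as ℕ-Solver
open import Data.List using (List; []; _∷_; map; concatMap; applyUpTo; filter; length; _++_)
open import Data.List.Relation.Unary.Linked using (linked?)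
open import Data.Nat using (ℕ; zero; suc; _+_; _*_; _∸_; _≤_; _<_; _≤ᵇ_; _≤?_; z≤n; s≤s; s≤s⁻¹)
open import Data.Nat.Combinatorics using (_C_; nCk+nC[k+1]≡[n+1]C[k+1]; nCk≡nC[n∸k]; nCn≡1)
open import Data.Nat.Properties
  using (+-suc; +-comm; +-assoc; +-identityʳ; *-identityʳ; *-distribˡ-+; *-zeroʳ;
         m+[n∸m]≡n; m+n∸m≡n; ≤-trans; m≤n⇒m≤1+n; 0∸n≡0; +-commutativeSemigroup)
open import Algebra.Properties.CommutativeSemigroup +-commutativeSemigroup
  using (interchange; xy∙z≈y∙xz)
open import Function using (_∘_)
open import Relation.Binary.PropositionalEquality
open import Relation.Nullary using (does)
open import Relation.Unary using (Pred; Decidable)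

open ≡-Reasoning

∑< : ℕ → (ℕ → ℕ) → ℕ
∑< zero    g = 0
∑< (suc N) g = g 0 + ∑< N (g ∘ suc)

syntax ∑< N (λ d → g) = ∑[ d < N ] g

∑-cong-< : ∀ N {g h : ℕ → ℕ} → (∀ d → d < N → g d ≡ h d) → ∑< N g ≡ ∑< N h
∑-cong-< zero    eq = refl
∑-cong-< (suc N) eq = cong₂ _+_ (eq 0 (s≤s z≤n)) (∑-cong-< N (λ d d<N → eq (suc d) (s≤s d<N)))

∑-cong : ∀ N {g h : ℕ → ℕ} → (∀ d → g d ≡ h d) → ∑< N g ≡ ∑< N h
∑-cong N eq = ∑-cong-< N (λ d _ → eq d)

∑-+ : ∀ N (g h : ℕ → ℕ) → ∑[ d < N ] (g d + h d) ≡ ∑< N g + ∑< N h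
∑-+ zero    g h = refl
∑-+ (suc N) g h = begin
  g 0 + h 0 + ∑[ d < N ] (g (suc d) + h (suc d)) ≡⟨ cong (_+_ (g 0 + h 0)) (∑-+ N (g ∘ suc) (h ∘ suc)) ⟩
  g 0 + h 0 + (∑< N (g ∘ suc) + ∑< N (h ∘ suc))  ≡⟨ interchange (g 0) (h 0) _ _ ⟩
  g 0 + ∑< N (g ∘ suc) + (h 0 + ∑< N (h ∘ suc))  ∎

*-distribˡ-∑ : ∀ N c (g : ℕ → ℕ) → c * ∑< N g ≡ ∑[ d < N ] (c * g d)
*-distribˡ-∑ zero    c g = *-zeroʳ c
*-distribˡ-∑ (suc N) c g =
  trans (*-distribˡ-+ c (g 0) _) (cong (_+_ (c * g 0)) (*-distribˡ-∑ N c (g ∘ suc)))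

≤ᵇ-suc : ∀ t x → (suc t ≤ᵇ suc x) ≡ (t ≤ᵇ x)
≤ᵇ-suc zero    x = refl
≤ᵇ-suc (suc t) x = refl

∑-from : ∀ t N (g : ℕ → ℕ) →
  ∑[ x < N ] (if t ≤ᵇ x then g x else 0) ≡ ∑[ d < N ∸ t ] (g (t + d))
∑-from zero    N       g = refl
∑-from (suc t) zero    g = refl
∑-from (suc t) (suc N) g =
  trans (∑-cong N (λ x → cong (λ c → if c then g (suc x) else 0) (≤ᵇ-suc t x)))
        (∑-from t N (g ∘ suc))

m<1+n∸o⇒o+m≤n : ∀ o n m → m < suc n ∸ o → o + m ≤ n
m<1+n∸o⇒o+m≤n zero    n       m m<1+n = s≤s⁻¹ m<1+n
m<1+n∸o⇒o+m≤n (suc o) zero    m m<0   rewrite 0∸n≡0 o with m<0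
... | ()
m<1+n∸o⇒o+m≤n (suc o) (suc n) m m<n∸o = s≤s (m<1+n∸o⇒o+m≤n o n m m<n∸o)

hockey-stick : ∀ e y r → (y + e) C suc r ≡ y C suc r + ∑[ d < e ] ((y + d) C r)
hockey-stick zero    y r = trans (cong (_C suc r) (+-identityʳ y)) (sym (+-identityʳ _))
hockey-stick (suc e) y r = begin
  (y + suc e) C suc r                                  ≡⟨ cong (_C suc r) (+-suc y e) ⟩
  (suc y + e) C suc r                                  ≡⟨ hockey-stick e (suc y) r ⟩
  suc y C suc r + ∑[ d < e ] ((suc y + d) C r)         ≡⟨ cong (_+ ∑[ d < e ] ((suc y + d) C r))
                                                            (nCk+nC[k+1]≡[n+1]C[k+1] y r) ⟨
  y C r + y C suc r + ∑[ d < e ] ((suc y + d) C r)     ≡⟨ xy∙z≈y∙xz (y C r) (y C suc r) _ ⟩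
  y C suc r + (y C r + ∑[ d < e ] ((suc y + d) C r))   ≡⟨ cong₂ (λ a s → y C suc r + (a C r + s))
                                                            (sym (+-identityʳ y))
                                                            (∑-cong e (λ d → cong (_C r) (sym (+-suc y d)))) ⟩
  y C suc r + ∑[ d < suc e ] ((y + d) C r)             ∎

-- chainSum b k t w sums w(a_{k-1}) over all t ≤ a_0 ≤ … ≤ a_{k-1} with a_j ≤ b j
-- (it is w t when k = 0); the first entry is written t + d.
chainSum : (ℕ → ℕ) → ℕ → ℕ → (ℕ → ℕ) → ℕ
chainSum b zero    t w = w t
chainSum b (suc k) t w = ∑[ d < suc (b 0) ∸ t ] (chainSum (b ∘ suc) k (t + d) w)

chainSum-cong : ∀ b k t {w v : ℕ → ℕ} → (∀ y → w y ≡ v y) → chainSum b k t w ≡ chainSum b k t v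
chainSum-cong b zero    t eq = eq t
chainSum-cong b (suc k) t eq =
  ∑-cong (suc (b 0) ∸ t) (λ d → chainSum-cong (b ∘ suc) k (t + d) eq)

chainSum-cong-≤ : ∀ b k t {w v : ℕ → ℕ} → (∀ y → y ≤ b k → w y ≡ v y) →
  chainSum b (suc k) t w ≡ chainSum b (suc k) t v
chainSum-cong-≤ b zero    t eq =
  ∑-cong-< (suc (b 0) ∸ t) (λ d d< → eq (t + d) (m<1+n∸o⇒o+m≤n t (b 0) d d<))
chainSum-cong-≤ b (suc k) t eq =
  ∑-cong (suc (b 0) ∸ t) (λ d → chainSum-cong-≤ (b ∘ suc) k (t + d) eq)

chainSum-+ : ∀ b k t (w v : ℕ → ℕ) →
  chainSum b k t (λ y → w y + v y) ≡ chainSum b k t w + chainSum b k t v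
chainSum-+ b zero    t w v = refl
chainSum-+ b (suc k) t w v =
  trans (∑-cong (suc (b 0) ∸ t) (λ d → chainSum-+ (b ∘ suc) k (t + d) w v))
        (∑-+ (suc (b 0) ∸ t) _ _)

*-distribˡ-chainSum : ∀ b k t c (w : ℕ → ℕ) →
  c * chainSum b k t w ≡ chainSum b k t (λ y → c * w y)
*-distribˡ-chainSum b zero    t c w = refl
*-distribˡ-chainSum b (suc k) t c w =
  trans (*-distribˡ-∑ (suc (b 0) ∸ t) c _)
        (∑-cong (suc (b 0) ∸ t) (λ d → *-distribˡ-chainSum (b ∘ suc) k (t + d) c w))

chainSum-snoc : ∀ b k t (w : ℕ → ℕ) →
  chainSum b (suc k) t w ≡ chainSum b k t (λ y → ∑[ d < suc (b k) ∸ y ] (w (y + d)))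
chainSum-snoc b zero    t w = refl
chainSum-snoc b (suc k) t w =
  ∑-cong (suc (b 0) ∸ t) (λ d → chainSum-snoc (b ∘ suc) k (t + d) w)

count : (List ℕ → Bool) → List (List ℕ) → ℕ
count p []       = 0
count p (xs ∷ L) = (if p xs then 1 else 0) + count p L

length-filter≡count : ∀ {ℓ} {P : Pred (List ℕ) ℓ} (P? : Decidable P) (p : List ℕ → Bool) →
  (∀ xs → does (P? xs) ≡ p xs) → ∀ L → length (filter P? L) ≡ count p L
length-filter≡count P? p eq []       = refl
length-filter≡count P? p eq (xs ∷ L) rewrite sym (eq xs) with does (P? xs)
... | true  = cong suc (length-filter≡count P? p eq L)
... | false = length-filter≡count P? p eq L

count-++ : ∀ p A B → count p (A ++ B) ≡ count p A + count p B
count-++ p []       B = refl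
count-++ p (xs ∷ A) B = trans (cong (_+_ hit) (count-++ p A B)) (sym (+-assoc hit (count p A) _))
  where hit = if p xs then 1 else 0

count-map : ∀ p (h : List ℕ → List ℕ) L → count p (map h L) ≡ count (p ∘ h) L
count-map p h []       = refl
count-map p h (xs ∷ L) = cong (_+_ (if p (h xs) then 1 else 0)) (count-map p h L)

count-false : ∀ L → count (λ _ → false) L ≡ 0
count-false []      = refl
count-false (x ∷ L) = count-false L

count-∧ : ∀ c (q : List ℕ → Bool) L → count (λ ys → c ∧ q ys) L ≡ (if c then count q L else 0)
count-∧ true  q L = refl
count-∧ false q L = count-false L

count-concatMap : ∀ p (G : ℕ → List (List ℕ)) (h : ℕ → ℕ) N →
  count p (concatMap G (applyUpTo h N)) ≡ ∑[ x < N ] (count p (G (h x)))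
count-concatMap p G h zero    = refl
count-concatMap p G h (suc N) =
  trans (count-++ p (G (h 0)) _) (cong (_+_ _) (count-concatMap p G (h ∘ suc) N))

isChainFrom : ℕ → List ℕ → Bool
isChainFrom t xs = does (linked? _≤?_ (t ∷ xs))

count-isChainFrom : ∀ b k t → count (isChainFrom t) (box b k) ≡ chainSum b k t (λ _ → 1)
count-isChainFrom b zero    t = refl
count-isChainFrom b (suc k) t = begin
  count (isChainFrom t) (box b (suc k))
    ≡⟨ count-concatMap (isChainFrom t) (λ x → map (x ∷_) (box (b ∘ suc) k)) (λ x → x) (suc (b 0)) ⟩
  ∑[ x < suc (b 0) ] (count (isChainFrom t) (map (x ∷_) (box (b ∘ suc) k)))
    ≡⟨ ∑-cong (suc (b 0)) (λ x → trans (count-map (isChainFrom t) (x ∷_) (box (b ∘ suc) k))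
                              (count-∧ (t ≤ᵇ x) (isChainFrom x) (box (b ∘ suc) k))) ⟩
  ∑[ x < suc (b 0) ] (if t ≤ᵇ x then count (isChainFrom x) (box (b ∘ suc) k) else 0)
    ≡⟨ ∑-cong (suc (b 0)) (λ x → cong (λ z → if t ≤ᵇ x then z else 0)
                                      (count-isChainFrom (b ∘ suc) k x)) ⟩
  ∑[ x < suc (b 0) ] (if t ≤ᵇ x then chainSum (b ∘ suc) k x (λ _ → 1) else 0)
    ≡⟨ ∑-from t (suc (b 0)) (λ x → chainSum (b ∘ suc) k x (λ _ → 1)) ⟩
  chainSum b (suc k) t (λ _ → 1) ∎

linked≡isChainFrom0 : ∀ xs → does (linked? _≤?_ xs) ≡ isChainFrom 0 xs
linked≡isChainFrom0 []       = refl
linked≡isChainFrom0 (x ∷ xs) = refl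

f≡chainSum : ∀ b n → f b n ≡ chainSum b (suc n) 0 (λ _ → 1)
f≡chainSum b n =
  trans (length-filter≡count (linked? _≤?_) (isChainFrom 0) linked≡isChainFrom0 (box b (suc n)))
        (count-isChainFrom b (suc n) 0)

chainBinomial : (ℕ → ℕ) → ℕ → ℕ → ℕ
chainBinomial b m r = chainSum b (suc m) 0 (_C r)

chainBinomial-0 : ∀ b m → chainBinomial b m 0 ≡ f b m
chainBinomial-0 b m = trans (chainSum-cong b (suc m) 0 nC0≡1) (sym (f≡chainSum b m))
  where
  nC0≡1 : ∀ n → n C 0 ≡ 1
  nC0≡1 n = trans (nCk≡nC[n∸k] {0} {n} z≤n) (nCn≡1 n)

chainBinomial-recurrence : ∀ b → (∀ i → b i ≤ b (suc i)) → ∀ m r →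
  (suc (b (suc m)) C suc r) * f b m ≡ chainBinomial b m (suc r) + chainBinomial b (suc m) r
chainBinomial-recurrence b mono m r = begin
  c * f b m
    ≡⟨ cong (c *_) (f≡chainSum b m) ⟩
  c * chainSum b (suc m) 0 (λ _ → 1)
    ≡⟨ *-distribˡ-chainSum b (suc m) 0 c (λ _ → 1) ⟩
  chainSum b (suc m) 0 (λ _ → c * 1)
    ≡⟨ chainSum-cong-≤ b m 0 split ⟩
  chainSum b (suc m) 0 (λ y → y C suc r + ∑[ d < B ∸ y ] ((y + d) C r))
    ≡⟨ chainSum-+ b (suc m) 0 _ _ ⟩
  chainBinomial b m (suc r) + chainSum b (suc m) 0 (λ y → ∑[ d < B ∸ y ] ((y + d) C r))
    ≡⟨ cong (_+_ (chainBinomial b m (suc r))) (sym (chainSum-snoc b (suc m) 0 (_C r))) ⟩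
  chainBinomial b m (suc r) + chainBinomial b (suc m) r ∎
  where
  B = suc (b (suc m))
  c = B C suc r
  split : ∀ y → y ≤ b m → c * 1 ≡ y C suc r + ∑[ d < B ∸ y ] ((y + d) C r)
  split y y≤bm = begin
    c * 1                                     ≡⟨ *-identityʳ c ⟩
    B C suc r                                 ≡⟨ cong (_C suc r) (sym (m+[n∸m]≡n y≤B)) ⟩
    (y + (B ∸ y)) C suc r                     ≡⟨ hockey-stick (B ∸ y) y r ⟩
    y C suc r + ∑[ d < B ∸ y ] ((y + d) C r)  ∎
    where y≤B = m≤n⇒m≤1+n (≤-trans y≤bm (mono m))

sgn-suc : ∀ r → sgn (suc r) ≡ ℤ.- sgn r
sgn-suc zero          = refl
sgn-suc (suc zero)    = refl
sgn-suc (suc (suc r)) = sgn-suc r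

sgn-[k+k]+r : ∀ k r → sgn (k + k + r) ≡ sgn r
sgn-[k+k]+r zero    r = refl
sgn-[k+k]+r (suc k) r = trans (cong (λ z → sgn (suc z + r)) (+-suc k k)) (sgn-[k+k]+r k r)

rhsLeading : (ℕ → ℕ) → ℕ → ℤ
rhsLeading b n = sgn n ℤ.* + ((b 0 + 1) C (n + 1))

rhsTerm : (ℕ → ℕ) → ℕ → ℕ → ℤ
rhsTerm b n m = sgn (m + n + 1) ℤ.* + ((1 + b (suc m)) C (n ∸ m)) ℤ.* + f b m

rhsUpTo : (ℕ → ℕ) → ℕ → ℕ → ℤ
rhsUpTo b n k = rhsLeading b n ℤ.+ sumBelow k (rhsTerm b n)

rhsTerm-diagonal : ∀ b k r → rhsTerm b (suc k + r) k ≡ sgn r ℤ.* + ((suc (b (suc k)) C suc r) * f b k)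
rhsTerm-diagonal b k r = begin
  sgn (k + n + 1) ℤ.* + (B C (n ∸ k)) ℤ.* + f b k ≡⟨ cong₂ (λ s e → s ℤ.* + (B C e) ℤ.* + f b k) sign n∸k≡1+r ⟩
  sgn r ℤ.* + (B C suc r) ℤ.* + f b k             ≡⟨ ℤ.*-assoc (sgn r) _ _ ⟩
  sgn r ℤ.* (+ (B C suc r) ℤ.* + f b k)           ≡⟨ cong (sgn r ℤ.*_) (ℤ.pos-* (B C suc r) (f b k)) ⟨
  sgn r ℤ.* + ((B C suc r) * f b k)               ∎
  where
  n = suc k + r
  B = 1 + b (suc k)
  sign : sgn (k + n + 1) ≡ sgn r
  sign = trans (cong sgn (regroup k r)) (sgn-[k+k]+r (suc k) r)
    where
    regroup : ∀ k r → k + (suc k + r) + 1 ≡ suc k + suc k + r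
    regroup = ℕ-Solver.solve-∀
  n∸k≡1+r : n ∸ k ≡ suc r
  n∸k≡1+r = trans (cong (_∸ k) (sym (+-suc k r))) (m+n∸m≡n k (suc r))

rhsUpTo-telescopes : ∀ b → (∀ i → b i ≤ b (suc i)) → ∀ k r →
  rhsUpTo b (k + r) k ≡ sgn r ℤ.* + chainBinomial b k r
rhsUpTo-telescopes b mono zero r = trans (ℤ.+-identityʳ _) (cong (λ z → sgn r ℤ.* + z) leading)
  where
  leading : (b 0 + 1) C (r + 1) ≡ chainBinomial b 0 r
  leading = trans (cong₂ _C_ (+-comm (b 0) 1) (+-comm r 1)) (hockey-stick (suc (b 0)) 0 r)
rhsUpTo-telescopes b mono (suc k) r = begin
  rhsUpTo b n (suc k)                               ≡⟨ ℤ.+-assoc (rhsLeading b n) (sumBelow k (rhsTerm b n)) _ ⟨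
  rhsUpTo b n k ℤ.+ rhsTerm b n k                   ≡⟨ cong₂ ℤ._+_ previous (rhsTerm-diagonal b k r) ⟩
  sgn (suc r) ℤ.* + p ℤ.+ sgn r ℤ.* + ((suc (b (suc k)) C suc r) * f b k)
                                                    ≡⟨ cong₂ (λ s z → s ℤ.* + p ℤ.+ sgn r ℤ.* z) (sgn-suc r)
                                                         (trans (cong +_ (chainBinomial-recurrence b mono k r))
                                                                (ℤ.pos-+ p q)) ⟩
  ℤ.- sgn r ℤ.* + p ℤ.+ sgn r ℤ.* (+ p ℤ.+ + q)     ≡⟨ cancel (sgn r) (+ p) (+ q) ⟩
  sgn r ℤ.* + q                                     ∎
  where
  n = suc k + r
  p = chainBinomial b k (suc r)
  q = chainBinomial b (suc k) r
  cancel : ∀ s x y → ℤ.- s ℤ.* x ℤ.+ s ℤ.* (x ℤ.+ y) ≡ s ℤ.* y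
  cancel = solve-∀
  previous : rhsUpTo b n k ≡ sgn (suc r) ℤ.* + p
  previous = subst (λ n → rhsUpTo b n k ≡ sgn (suc r) ℤ.* + p) (+-suc k r)
                   (rhsUpTo-telescopes b mono k (suc r))

theorem1 : (b : ℕ → ℕ) → (∀ i → b i ≤ b (suc i)) → (n : ℕ) →
    + f b n ≡ sgn n ℤ.* + ((b 0 + 1) C (n + 1))
      ℤ.+ sumBelow n (λ m → sgn (m + n + 1) ℤ.* + ((1 + b (suc m)) C (n ∸ m)) ℤ.* + f b m)
theorem1 b mono n = sym (begin
  rhsUpTo b n n                   ≡⟨ cong (λ z → rhsUpTo b z n) (+-identityʳ n) ⟨
  rhsUpTo b (n + 0) n             ≡⟨ rhsUpTo-telescopes b mono n 0 ⟩
  sgn 0 ℤ.* + chainBinomial b n 0 ≡⟨ ℤ.*-identityˡ _ ⟩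
  + chainBinomial b n 0           ≡⟨ cong +_ (chainBinomial-0 b n) ⟩
  + f b n                         ∎)
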